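{- Let $G$ be a connected reduced graph with $V(G)=\{1,\dots,n\}$, let $v\in V(G)$, and suppose that the standard decomposition of $G$ from $v$ has $|S|=2$. Then in the extended decomposition of $G$ from $v$, we have $x\notin V(P)$ and $d_H(z)\ge2$.
   Context: $\Gamma_G(v)$ is the neighbourhood of $v$, $\Gamma_G(Y)=\bigcup_{u\in Y}\Gamma_G(u)\setminus Y$, $\Gamma^2_G(v)$ the set of vertices at distance exactly $2$ from $v$, $d_G(u)$ the degree of $u$. A graph is a near-forest if it has no vertices or contains a vertex $u$ such that deleting $u$ and its neighbours leaves a forest. $G$ is reduced if every non-empty $Y\subseteq V(G)$ with $G[Y]$ a near-forest has $|\Gamma_G(Y)|\ge2$. Standard decomposition of $G$ from $v$: $H_1,\dots,H_k$ are the non-tree components and $T_1,\dots,T_\ell$ the tree components of $G-v-\Gamma_G(v)$; $S=(V(H_1)\cup\dots\cup V(H_k))\cap\Gamma^2_G(v)$; $X=\{v\}\cup\Gamma_G(v)\cup V(T_1)\cup\dots\cup V(T_\ell)$. Extended decomposition (when $|S|=2$): $S=\{x,y\}$ with $x<y$; if $d_{G-X}(y)\ge2$ then $z=y$, otherwise $z$ is the (unique) closest vertex to $y$ in $G-X$ with $d_{G-X}(z)>2$; $P$ is the (unique) $y$–$z$ path in $G-X$; $X^+=X\cup V(P)\setminus\{z\}$; $H=G-X^+$. (Under the hypotheses, $z$ and $P$ are well defined.) -}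

module Defs where

open import Data.Nat using (ℕ; suc; _≤_)
open import Data.Fin using (Fin)
open import Data.Bool using (Bool; T; false)
open import Data.Unit using (⊤)
open import Data.List using (List; []; _∷_; length)
open import Data.List.Membership.Propositional using (_∈_)
open import Data.List.Relation.Unary.Unique.Propositional using (Unique)
open import Data.Product using (Σ; ∃; _×_; _,_)
open import Data.Sum using (_⊎_)
open import Relation.Nullary using (¬_)
open import Relation.Binary.PropositionalEquality using (_≡_; _≢_)
open import Function.Definitions using (Injective)

-- A finite simple graph with vertex set Fin n (standing for {1,…,n}).
record Graph (n : ℕ) : Set where
  field
    adj   : Fin n → Fin n → Bool
    sym   : ∀ u w → adj u w ≡ adj w u
    irrefl : ∀ u → adj u u ≡ false
open Graph public

VSet : ℕ → Set₁
VSet n = Fin n → Set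

module _ {n : ℕ} (G : Graph n) where

  Adj : Fin n → Fin n → Set
  Adj u w = T (adj G u w)

  AtLeast : ℕ → VSet n → Set
  AtLeast k A = Σ (Fin k → Fin n) λ f → Injective _≡_ _≡_ f × (∀ i → A (f i))

  data Walk (A : VSet n) : Fin n → Fin n → List (Fin n) → Set where
    single : ∀ {u} → A u → Walk A u u (u ∷ [])
    step   : ∀ {u w t vs} → A u → Adj u w → Walk A w t vs → Walk A u t (u ∷ vs)

  Path : VSet n → Fin n → Fin n → List (Fin n) → Set
  Path A u t vs = Walk A u t vs × Unique vs

  HasCycle : VSet n → Set
  HasCycle A = Σ (Fin n) λ u → Σ (Fin n) λ t → Σ (List (Fin n)) λ vs →
    Path A u t vs × 3 ≤ length vs × Adj t u

  Forest : VSet n → Set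
  Forest A = ¬ HasCycle A

  Connected : Set
  Connected = ∀ u w → ∃ λ vs → Walk (λ _ → ⊤) u w vs

  Nbhd : Fin n → VSet n
  Nbhd v w = Adj v w

  NbhdSet : VSet n → VSet n
  NbhdSet Y w = (∃ λ u → Y u × Adj u w) × ¬ Y w

  Dist2 : Fin n → VSet n
  Dist2 v w = w ≢ v × ¬ Adj v w × (∃ λ u → Adj v u × Adj u w)

  NearForest : VSet n → Set
  NearForest Y = (∀ u → ¬ Y u) ⊎
    (∃ λ u → Y u × Forest (λ w → Y w × w ≢ u × ¬ Adj u w))

  Reduced : Set₁
  Reduced = ∀ (Y : VSet n) → (∃ λ u → Y u) → NearForest Y → AtLeast 2 (NbhdSet Y)

  DegAtLeast : VSet n → Fin n → ℕ → Set
  DegAtLeast A u k = AtLeast k (λ w → Adj u w × A w)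

  module StdDecomp (v : Fin n) where
    W : VSet n
    W w = w ≢ v × ¬ Adj v w

    Comp : Fin n → VSet n
    Comp w₀ w = ∃ λ vs → Walk W w₀ w vs

    InNonTree : VSet n
    InNonTree w = W w × HasCycle (Comp w)

    InTree : VSet n
    InTree w = W w × ¬ HasCycle (Comp w)

    S : VSet n
    S w = InNonTree w × Dist2 v w

    X : VSet n
    X w = (w ≡ v) ⊎ Adj v w ⊎ InTree w

    NotX : VSet n
    NotX w = ¬ X w

    -- z is a valid choice of z in the extended decomposition (given y)
    ZSpec : Fin n → Fin n → Set
    ZSpec y z =
      (DegAtLeast NotX y 2 × z ≡ y) ⊎
      (¬ DegAtLeast NotX y 2 × NotX z × DegAtLeast NotX z 3 ×
        (∃ λ vs → Walk NotX y z vs ×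
          (∀ z′ ws → NotX z′ → DegAtLeast NotX z′ 3 → Walk NotX y z′ ws →
            length vs ≤ length ws)))

    XPlus : Fin n → List (Fin n) → VSet n
    XPlus z P w = (X w ⊎ w ∈ P) × w ≢ z

    HVerts : Fin n → List (Fin n) → VSet n
    HVerts z P w = ¬ XPlus z P w

-- If z = y then P = y and both claims are immediate.  Otherwise put X⁺ = (X ∪ V(P)) ∖ {z}.  Since z is
-- the nearest branch vertex of G − X seen from the leaf y, the path P is a pendant path of G − X: its
-- interior vertices have no neighbours in G − X off P, they span no cycle, and only the last of them
-- is adjacent to z.  Hence G[X⁺] is a near-forest centred at v (tree components together with a bare
-- path), and every vertex of Γ(X⁺) other than z would have to be a vertex of S outside P.  If x lay on
-- P, then S = {x, y} ⊆ V(P) and Γ(X⁺) ⊆ {z}, contradicting reducedness.  Finally z has at least three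
-- neighbours in G − X, at most one of which lies on P, so at least two of them remain in H.
module Submission where

open import Defs
open import Data.Nat using (ℕ)
open import Data.Fin using (Fin; _<_)
open import Data.List using (List)
open import Data.List.Membership.Propositional using (_∈_)
open import Data.Product using (_×_)
open import Data.Sum using (_⊎_)
open import Relation.Nullary using (¬_)
open import Relation.Binary.PropositionalEquality using (_≡_)

open import Data.Nat using (suc; _≤_; z≤n; s≤s) renaming (_<_ to _<ℕ_)
open import Data.Nat.Properties using (≤-refl; ≤-trans; m≤n⇒m≤1+n; <-≤-trans; <-irrefl)
open import Data.Fin using (zero; suc; _≟_)
import Data.Fin.Properties as Fin
open import Data.List using ([]; _∷_; length; _∷ʳ_)
open import Data.List.Properties using (∷ʳ-injectiveˡ; ∷ʳ-injectiveʳ)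
open import Data.List.Membership.Propositional using (_∉_)
open import Data.List.Relation.Unary.Any using (here; there)
open import Data.List.Relation.Unary.Any.Properties using (singleton⁻)
open import Data.List.Relation.Unary.All using ([]; lookup)
open import Data.List.Relation.Unary.All.Properties using (¬Any⇒All¬)
open import Data.List.Relation.Unary.AllPairs using ([]; _∷_)
open import Data.List.Relation.Unary.Unique.Propositional using (Unique)
open import Data.List.Relation.Unary.Unique.Propositional.Properties using (Unique[x∷xs]⇒x∉xs)
open import Data.Product using (∃; _,_; proj₁; proj₂)
open import Data.Sum using (inj₁; inj₂; [_,_])
open import Data.Bool using (T)
open import Data.Empty using (⊥; ⊥-elim)
open import Function using (_∘_; case_of_)
open import Function.Definitions using (Injective)
open import Relation.Nullary using (Dec; yes; no)
open import Relation.Unary using (Decidable)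
open import Relation.Binary.PropositionalEquality using (_≢_; refl; cong; subst; ≢-sym)
import Relation.Binary.PropositionalEquality as ≡

_∖_ : ∀ {n} → VSet n → Fin n → VSet n
(A ∖ u) c = A c × c ≢ u

module _ {n : ℕ} (G : Graph n) where

  open import Data.List.Membership.DecPropositional (_≟_ {n}) using (_∈?_)

  private
    variable
      A B Q : VSet n
      u w t c c′ q z : Fin n
      vs ps qs cs : List (Fin n)
      k : ℕ

  Adj-sym : Adj G u w → Adj G w u
  Adj-sym {u} {w} = subst T (Graph.sym G u w)

  Adj⇒≢ : Adj G u w → u ≢ w
  Adj⇒≢ {u} u~u refl = subst T (irrefl G u) u~u

  DegAtLeast-mono : (∀ {w} → Adj G u w → A w → B w) → DegAtLeast G A u k → DegAtLeast G B u k
  DegAtLeast-mono A⇒B (f , f-inj , f-nbr) =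
    f , f-inj , λ i → proj₁ (f-nbr i) , A⇒B (proj₁ (f-nbr i)) (proj₂ (f-nbr i))

  DegAtLeast-zero : DegAtLeast G A u 0
  DegAtLeast-zero = (λ ()) , (λ { {()} }) , λ ()

  DegAtLeast-suc : Adj G u w → A w → DegAtLeast G (A ∖ w) u k → DegAtLeast G A u (suc k)
  DegAtLeast-suc {u = u} {w = w} {A = A} {k = k} u~w Aw (f , f-inj , f-nbr) = g , g-inj , g-nbr
    where
    g : Fin (suc k) → Fin n
    g zero = w
    g (suc i) = f i
    g-inj : Injective _≡_ _≡_ g
    g-inj {zero} {zero} _ = refl
    g-inj {zero} {suc j} w≡fj = ⊥-elim (proj₂ (proj₂ (f-nbr j)) (≡.sym w≡fj))
    g-inj {suc i} {zero} fi≡w = ⊥-elim (proj₂ (proj₂ (f-nbr i)) fi≡w)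
    g-inj {suc i} {suc j} fi≡fj = cong suc (f-inj fi≡fj)
    g-nbr : ∀ i → Adj G u (g i) × A (g i)
    g-nbr zero = u~w , Aw
    g-nbr (suc i) = proj₁ (f-nbr i) , proj₁ (proj₂ (f-nbr i))

  DegAtLeast-two : w ≢ t → Adj G u w → A w → Adj G u t → A t → DegAtLeast G A u 2
  DegAtLeast-two {w = w} {t = t} {A = A} w≢t u~w Aw u~t At =
    DegAtLeast-suc u~w Aw
      (DegAtLeast-suc {A = A ∖ w} u~t (At , ≢-sym w≢t) (DegAtLeast-zero {A = (A ∖ w) ∖ t}))

  deg<2⇒nbr-unique : ¬ DegAtLeast G A u 2 → Adj G u w → A w → Adj G u q → A q → q ≡ w
  deg<2⇒nbr-unique {w = w} {q = q} deg<2 u~w Aw u~q Aq with q ≟ w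
  ... | yes q≡w = q≡w
  ... | no q≢w = ⊥-elim (deg<2 (DegAtLeast-two q≢w u~q Aq u~w Aw))

  DegAtLeast-avoid : Decidable Q → (∀ {a b} → Adj G u a → Q a → Adj G u b → Q b → a ≡ b) →
    DegAtLeast G A u 3 → DegAtLeast G (λ w → A w × ¬ Q w) u 2
  DegAtLeast-avoid {Q = Q} {u = u} {A = A} Q? Q-nbr-unique (f , f-inj , f-nbr) =
    choose (Q? (f zero)) (Q? (f (suc zero))) (Q? (f (suc (suc zero))))
    where
    pair : ∀ i j → i ≢ j → ¬ Q (f i) → ¬ Q (f j) → DegAtLeast G (λ w → A w × ¬ Q w) u 2
    pair i j i≢j ¬Qi ¬Qj = DegAtLeast-two {A = λ w → A w × ¬ Q w} (i≢j ∘ f-inj)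
      (proj₁ (f-nbr i)) (proj₂ (f-nbr i) , ¬Qi) (proj₁ (f-nbr j)) (proj₂ (f-nbr j) , ¬Qj)
    clash : ∀ i j → i ≢ j → Q (f i) → Q (f j) → DegAtLeast G (λ w → A w × ¬ Q w) u 2
    clash i j i≢j Qi Qj = ⊥-elim (i≢j (f-inj (Q-nbr-unique (proj₁ (f-nbr i)) Qi (proj₁ (f-nbr j)) Qj)))
    choose : Dec (Q (f zero)) → Dec (Q (f (suc zero))) → Dec (Q (f (suc (suc zero)))) →
      DegAtLeast G (λ w → A w × ¬ Q w) u 2
    choose (no ¬Q₀) (no ¬Q₁) _        = pair zero (suc zero) (λ ()) ¬Q₀ ¬Q₁
    choose (no ¬Q₀) (yes _)  (no ¬Q₂) = pair zero (suc (suc zero)) (λ ()) ¬Q₀ ¬Q₂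
    choose (yes _)  (no ¬Q₁) (no ¬Q₂) = pair (suc zero) (suc (suc zero)) (λ ()) ¬Q₁ ¬Q₂
    choose (yes Q₀) (yes Q₁) _        = clash zero (suc zero) (λ ()) Q₀ Q₁
    choose (yes Q₀) (no _)   (yes Q₂) = clash zero (suc (suc zero)) (λ ()) Q₀ Q₂
    choose (no _)   (yes Q₁) (yes Q₂) = clash (suc zero) (suc (suc zero)) (λ ()) Q₁ Q₂

  walk-head∈ : Walk G A u t vs → u ∈ vs
  walk-head∈ (single _) = here refl
  walk-head∈ (step _ _ _) = here refl

  walk-last∈ : Walk G A u t vs → t ∈ vs
  walk-last∈ (single _) = here refl
  walk-last∈ (step _ _ W) = there (walk-last∈ W)

  walk-⊆ : Walk G A u t vs → c ∈ vs → A c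
  walk-⊆ (single Au) (here refl) = Au
  walk-⊆ (step Au _ _) (here refl) = Au
  walk-⊆ (step _ _ W) (there c∈vs) = walk-⊆ W c∈vs

  walk-restrict : Walk G A u t vs → (∀ {c} → c ∈ vs → B c) → Walk G B u t vs
  walk-restrict (single _) B-vs = single (B-vs (here refl))
  walk-restrict (step _ u~w W) B-vs = step (B-vs (here refl)) u~w (walk-restrict W (B-vs ∘ there))

  walk-invariant : (∀ {a b} → A a → A b → Adj G a b → Q a → Q b) →
    Q u → Walk G A u t vs → c ∈ vs → Q c
  walk-invariant _ Qu (single _) (here refl) = Qu
  walk-invariant _ Qu (step _ _ _) (here refl) = Qu
  walk-invariant Q-step Qu (step Au u~w W) (there c∈vs) =
    walk-invariant Q-step (Q-step Au (walk-⊆ W (walk-head∈ W)) u~w Qu) W c∈vs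

  walk-reach : Walk G A u t vs → c ∈ vs → ∃ λ ws → Walk G A u c ws
  walk-reach (single Au) (here refl) = _ , single Au
  walk-reach (step Au _ _) (here refl) = _ , single Au
  walk-reach (step Au u~w W) (there c∈vs) = let ws , Wc = walk-reach W c∈vs in _ , step Au u~w Wc

  walk-prefix : Walk G A u t vs → c ∈ vs → c ≢ t → ∃ λ ws → Walk G A u c ws × length ws <ℕ length vs
  walk-prefix (single _) (here refl) c≢t = ⊥-elim (c≢t refl)
  walk-prefix (step Au _ (single _)) (here refl) _ = _ , single Au , s≤s (s≤s z≤n)
  walk-prefix (step Au _ (step _ _ _)) (here refl) _ = _ , single Au , s≤s (s≤s z≤n)
  walk-prefix (step Au u~w W) (there c∈vs) c≢t =
    let ws , Wc , ws<vs = walk-prefix W c∈vs c≢t in _ , step Au u~w Wc , s≤s ws<vs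

  walk-last-pred : Walk G A u t vs → t ≢ u → ∃ λ p → p ∈ vs × Adj G p t
  walk-last-pred (single _) t≢u = ⊥-elim (t≢u refl)
  walk-last-pred {t = t} (step {w = w} _ u~w W) _ with t ≟ w
  ... | yes refl = _ , here refl , u~w
  ... | no t≢w = let p , p∈vs , p~t = walk-last-pred W t≢w in p , there p∈vs , p~t

  path-self : Path G A u u vs → vs ≡ u ∷ []
  path-self (single _ , _) = refl
  path-self (step _ _ W , U) = ⊥-elim (Unique[x∷xs]⇒x∉xs U (walk-last∈ W))

  path-tail : Walk G A w t ps → Unique (u ∷ ps) → Path G (A ∖ u) w t ps
  path-tail W (u∉ps ∷ U) = walk-restrict W (λ c∈ps → walk-⊆ W c∈ps , ≢-sym (lookup u∉ps c∈ps)) , U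

  path-suffix : Path G A w t ps → u ∈ ps → ∃ λ qs → Path G A u t qs × length qs ≤ length ps
  path-suffix P@(single _ , _) (here refl) = _ , P , ≤-refl
  path-suffix P@(step _ _ _ , _) (here refl) = _ , P , ≤-refl
  path-suffix (single _ , _) (there ())
  path-suffix (step _ _ W , _ ∷ U) (there u∈ps) =
    let qs , Q , qs≤ps = path-suffix (W , U) u∈ps in qs , Q , m≤n⇒m≤1+n qs≤ps

  walk⇒path : Walk G A u t vs → ∃ λ ps → Path G A u t ps × length ps ≤ length vs
  walk⇒path (single Au) = _ , (single Au , [] ∷ []) , ≤-refl
  walk⇒path {u = u} (step Au u~w W) with walk⇒path W
  ... | ps , (Wps , Ups) , ps≤vs with u ∈? ps
  ...   | yes u∈ps =
    let qs , Q , qs≤ps = path-suffix (Wps , Ups) u∈ps in qs , Q , ≤-trans qs≤ps (m≤n⇒m≤1+n ps≤vs)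
  ...   | no u∉ps = u ∷ ps , (step Au u~w Wps , ¬Any⇒All¬ ps u∉ps ∷ Ups) , s≤s ps≤vs

  HasCycle-mono : (∀ {c} → A c → B c) → HasCycle G A → HasCycle G B
  HasCycle-mono A⊆B (u , t , vs , (W , U) , 3≤vs , t~u) =
    u , t , vs , (walk-restrict W (A⊆B ∘ walk-⊆ W) , U) , 3≤vs , t~u

  path-inner-deg2 : Path G A u t vs → c ∈ vs → c ≢ u → c ≢ t → DegAtLeast G (_∈ vs) c 2
  path-inner-deg2 (single _ , _) (here refl) c≢u _ = ⊥-elim (c≢u refl)
  path-inner-deg2 (step _ _ _ , _) (here refl) c≢u _ = ⊥-elim (c≢u refl)
  path-inner-deg2 {c = c} (step {w = w} _ _ W , _ ∷ U) (there c∈ps) _ c≢t with c ≟ w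
  path-inner-deg2 (step _ _ (single _) , _) _ _ c≢t | yes refl = ⊥-elim (c≢t refl)
  path-inner-deg2 (step _ u~w (step _ w~w′ W) , u∉ps ∷ _) _ _ _ | yes refl =
    DegAtLeast-two (lookup u∉ps (there (walk-head∈ W)))
      (Adj-sym u~w) (here refl) w~w′ (there (there (walk-head∈ W)))
  ... | no c≢w = DegAtLeast-mono {A = _∈ _} (λ _ → there) (path-inner-deg2 (W , U) c∈ps c≢w c≢t)

  cycle-deg2 : Path G A u t vs → 3 ≤ length vs → Adj G t u → c ∈ vs → DegAtLeast G (_∈ vs) c 2
  cycle-deg2 (single _ , _) (s≤s ())
  cycle-deg2 (step _ _ (single _) , _) (s≤s (s≤s ()))
  cycle-deg2 {u = u} {t = t} {c = c} P@(step {w = s} _ u~s W@(step _ _ W′) , u∉ps ∷ s∉ps ∷ _) _ t~u c∈vs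
    with c ≟ u | c ≟ t
  ... | yes refl | _ = DegAtLeast-two s≢t u~s (there (here refl)) (Adj-sym t~u) (walk-last∈ (proj₁ P))
    where
    s≢t : s ≢ t
    s≢t = lookup s∉ps (walk-last∈ W′)
  ... | no _ | yes refl =
    let p , p∈ps , p~t = walk-last-pred W (≢-sym (lookup s∉ps (walk-last∈ W′))) in
    DegAtLeast-two {A = _∈ _} (lookup u∉ps p∈ps) t~u (here refl) (Adj-sym p~t) (there p∈ps)
  ... | no c≢u | no c≢t = path-inner-deg2 P c∈vs c≢u c≢t

  PendantPath : VSet n → Fin n → Fin n → List (Fin n) → Set
  PendantPath A u z ps = Path G A u z ps
                       × (u ≢ z → ¬ DegAtLeast G A u 2)
                       × (∀ {c} → c ∈ ps → c ≢ z → ¬ DegAtLeast G A c 3)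

  pendant-tail : Adj G u w → A u → Walk G A w z ps → Unique (u ∷ ps) →
    (∀ {c} → c ∈ u ∷ ps → c ≢ z → ¬ DegAtLeast G A c 3) → PendantPath (A ∖ u) w z ps
  pendant-tail {u = u} {A = A} u~w Au W U inner =
      path-tail W U
    , (λ w≢z deg → inner (there (walk-head∈ W)) w≢z (DegAtLeast-suc (Adj-sym u~w) Au deg))
    , (λ c∈ps c≢z deg → inner (there c∈ps) c≢z (DegAtLeast-mono {A = A ∖ u} (λ _ → proj₁) deg))

  pendant-closed : PendantPath A u z ps → c ∈ ps → c ≢ z → Adj G c q → A q → q ∈ ps
  pendant-closed ((single _ , _) , _) (here refl) c≢z = ⊥-elim (c≢z refl)
  pendant-closed ((step _ u~w W , _) , leaf , _) (here refl) u≢z u~q Aq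
    rewrite deg<2⇒nbr-unique (leaf u≢z) u~w (walk-⊆ W (walk-head∈ W)) u~q Aq = there (walk-head∈ W)
  pendant-closed {u = u} {q = q} ((step Au u~w W , U) , _ , inner) (there c∈ps) c≢z c~q Aq with q ≟ u
  ... | yes refl = here refl
  ... | no q≢u = there (pendant-closed (pendant-tail u~w Au W U inner) c∈ps c≢z c~q (Aq , q≢u))

  pendant-unique : PendantPath A u z qs → Path G A u z ps → ps ≡ qs
  pendant-unique ((single _ , _) , _) (single _ , _) = refl
  pendant-unique ((single _ , _) , _) (step _ _ W , U) = ⊥-elim (Unique[x∷xs]⇒x∉xs U (walk-last∈ W))
  pendant-unique ((step _ _ W , U) , _) (single _ , _) = ⊥-elim (Unique[x∷xs]⇒x∉xs U (walk-last∈ W))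
  pendant-unique ((step Au u~w W , U@(u∉qs ∷ _)) , leaf , inner) (step _ u~w′ W′ , U′)
    with deg<2⇒nbr-unique (leaf (lookup u∉qs (walk-last∈ W))) u~w (walk-⊆ W (walk-head∈ W))
                          u~w′ (walk-⊆ W′ (walk-head∈ W′))
  ... | refl = cong (_ ∷_) (pendant-unique (pendant-tail u~w Au W U inner) (path-tail W′ U′))

  pendant-penultimate : PendantPath A u z ps → c ∈ ps → c ≢ z → Adj G c z →
    ∃ λ α → ps ≡ α ∷ʳ c ∷ʳ z
  pendant-penultimate ((single _ , _) , _) (here refl) c≢z = ⊥-elim (c≢z refl)
  pendant-penultimate ((step _ u~w W , _ ∷ U) , leaf , _) (here refl) u≢z u~z
    with deg<2⇒nbr-unique (leaf u≢z) u~w (walk-⊆ W (walk-head∈ W)) u~z (walk-⊆ W (walk-last∈ W))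
  ... | refl rewrite path-self (W , U) = [] , refl
  pendant-penultimate ((step Au u~w W , U) , _ , inner) (there c∈ps) c≢z c~z =
    let α , ps≡ = pendant-penultimate (pendant-tail u~w Au W U inner) c∈ps c≢z c~z
    in _ ∷ α , cong (_ ∷_) ps≡

  pendant-last-nbr-unique : PendantPath A u z ps →
    c ∈ ps → c ≢ z → Adj G c z → c′ ∈ ps → c′ ≢ z → Adj G c′ z → c ≡ c′
  pendant-last-nbr-unique {c = c} {c′ = c′} P c∈ps c≢z c~z c′∈ps c′≢z c′~z =
    let α , ps≡α = pendant-penultimate P c∈ps c≢z c~z
        β , ps≡β = pendant-penultimate P c′∈ps c′≢z c′~z
    in ∷ʳ-injectiveʳ α β (∷ʳ-injectiveˡ (α ∷ʳ c) (β ∷ʳ c′) (≡.trans (≡.sym ps≡α) ps≡β))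

  pendant-last-deg : PendantPath A u z ps → DegAtLeast G A z 3 → DegAtLeast G (λ w → A w × w ∉ ps) z 2
  pendant-last-deg {A = A} {ps = ps} P = DegAtLeast-avoid {Q = _∈ ps} {A = A} (_∈? ps) λ z~a a∈ps z~b b∈ps →
    pendant-last-nbr-unique P a∈ps (≢-sym (Adj⇒≢ z~a)) (Adj-sym z~a)
                              b∈ps (≢-sym (Adj⇒≢ z~b)) (Adj-sym z~b)

  -- The leaf at the head of the path cannot lie in cs, so cs lies in the interior of its tail.
  pendant-no-core : PendantPath A u z ps → (∀ {c} → c ∈ cs → c ∈ ps × c ≢ z) →
    (∀ {c} → c ∈ cs → DegAtLeast G (_∈ cs) c 2) → c ∉ cs
  pendant-no-core ((single _ , _) , _) cs⊆inner _ c∈cs with cs⊆inner c∈cs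
  ... | here refl , c≢z = c≢z refl
  pendant-no-core {A = A} {u = u} {cs = cs} ((step Au u~w W , U) , leaf , inner) cs⊆inner cs-deg2 c∈cs with u ∈? cs
  ... | yes u∈cs = leaf (proj₂ (cs⊆inner u∈cs)) (DegAtLeast-mono {A = _∈ cs} cs⊆A (cs-deg2 u∈cs))
    where
    cs⊆A : ∀ {d} → Adj G u d → d ∈ cs → A d
    cs⊆A _ d∈cs = walk-⊆ (step Au u~w W) (proj₁ (cs⊆inner d∈cs))
  ... | no u∉cs = pendant-no-core (pendant-tail u~w Au W U inner) cs⊆tail cs-deg2 c∈cs
    where
    cs⊆tail : ∀ {d} → d ∈ cs → d ∈ _ × d ≢ _
    cs⊆tail d∈cs with cs⊆inner d∈cs
    ... | here refl , _ = ⊥-elim (u∉cs d∈cs)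
    ... | there d∈ps , d≢z = d∈ps , d≢z

  pendant-acyclic : PendantPath A u z ps → Forest G (λ c → c ∈ ps × c ≢ z)
  pendant-acyclic P (_ , _ , _ , C , 3≤cs , t~u) =
    pendant-no-core P (walk-⊆ (proj₁ C)) (cycle-deg2 C 3≤cs t~u) (walk-head∈ (proj₁ C))

  shortest⇒pendant : ¬ DegAtLeast G A u 2 → Walk G A u z vs →
    (∀ z′ ws → A z′ → DegAtLeast G A z′ 3 → Walk G A u z′ ws → length vs ≤ length ws) →
    Path G A u z ps → PendantPath A u z ps
  -- A vertex of degree ≥ 3 before z on the shortened path would be reached by a walk shorter than vs.
  shortest⇒pendant {A = A} {u = u} {z = z} {vs = vs} leaf W shortest P =
    subst (PendantPath A u z) (≡.sym (pendant-unique shortened-pendant P)) shortened-pendant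
    where
    shortened : ∃ λ qs → Path G A u z qs × length qs ≤ length vs
    shortened = walk⇒path W
    shortened-pendant : PendantPath A u z (proj₁ shortened)
    shortened-pendant = proj₁ (proj₂ shortened) , (λ _ → leaf) , λ c∈qs c≢z deg3 →
      let Wqs = proj₁ (proj₁ (proj₂ shortened))
          ws , Wc , ws<qs = walk-prefix Wqs c∈qs c≢z
          qs≤ws = ≤-trans (proj₂ (proj₂ shortened)) (shortest _ ws (walk-⊆ Wqs c∈qs) deg3 Wc)
      in <-irrefl refl (<-≤-trans ws<qs qs≤ws)

module _ {n : ℕ} (G : Graph n) (v : Fin n) where

  open StdDecomp G v

  private
    variable
      u w z : Fin n
      P : List (Fin n)

  NotX⇒W : NotX w → W w
  NotX⇒W w∉X = w∉X ∘ inj₁ , w∉X ∘ inj₂ ∘ inj₁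

  InTree-step : InTree u → W w → Adj G u w → InTree w
  InTree-step (Wu , u-acyclic) Ww u~w = Ww , u-acyclic ∘ HasCycle-mono G λ (ws , Ww→) → _ , step Wu u~w Ww→

  InTree-¬Adj-NotX : InTree u → NotX w → ¬ Adj G u w
  InTree-¬Adj-NotX u-tree w∉X u~w = w∉X (inj₂ (inj₂ (InTree-step u-tree (NotX⇒W w∉X) u~w)))

  HVerts-intro : NotX w → (w ∈ P → w ≡ z) → HVerts z P w
  HVerts-intro w∉X _ (inj₁ w∈X , _) = w∉X w∈X
  HVerts-intro _ on-P (inj₂ w∈P , w≢z) = w≢z (on-P w∈P)

  module _ {y z : Fin n} {P : List (Fin n)} (pendant : PendantPath G NotX y z P) where

    private
      Core : VSet n
      Core w = XPlus z P w × w ≢ v × ¬ Adj G v w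

      Core⇒W : Core w → W w
      Core⇒W (_ , w≢v , v≁w) = w≢v , v≁w

      Core∩X⇒InTree : Core w → X w → InTree w
      Core∩X⇒InTree (_ , w≢v , _) (inj₁ w≡v) = ⊥-elim (w≢v w≡v)
      Core∩X⇒InTree (_ , _ , v≁w) (inj₂ (inj₁ v~w)) = ⊥-elim (v≁w v~w)
      Core∩X⇒InTree _ (inj₂ (inj₂ w-tree)) = w-tree

      P⊆NotX : ∀ {w} → w ∈ P → NotX w
      P⊆NotX = walk-⊆ G (proj₁ (proj₁ pendant))

    -- A cycle through a tree vertex stays in its tree component; any other cycle stays off X
    -- (tree vertices have no neighbours in G − X), so it lies in the interior of P.
    Core-forest : Forest G Core
    Core-forest (u₀ , t₀ , cs , (Wc , Uc) , 3≤cs , t~u)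
      with proj₁ (proj₁ (walk-⊆ G Wc (walk-head∈ G Wc)))
    ... | inj₁ u₀∈X =
      proj₂ u₀-tree (u₀ , t₀ , cs , (walk-restrict G Wc (walk-reach G Wc-in-W) , Uc) , 3≤cs , t~u)
      where
      u₀-tree : InTree u₀
      u₀-tree = Core∩X⇒InTree (walk-⊆ G Wc (walk-head∈ G Wc)) u₀∈X
      Wc-in-W : Walk G W u₀ t₀ cs
      Wc-in-W = walk-restrict G Wc (Core⇒W ∘ walk-⊆ G Wc)
    ... | inj₂ u₀∈P = pendant-acyclic G pendant
      (u₀ , t₀ , cs , (walk-restrict G Wc interior , Uc) , 3≤cs , t~u)
      where
      off-X : ∀ {c} → c ∈ cs → NotX c
      off-X = walk-invariant G (λ _ Cb a~b a∉X b∈X →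
        InTree-¬Adj-NotX (Core∩X⇒InTree Cb b∈X) a∉X (Adj-sym G a~b)) (P⊆NotX u₀∈P) Wc
      interior : ∀ {c} → c ∈ cs → c ∈ P × c ≢ z
      interior c∈cs with walk-⊆ G Wc c∈cs
      ... | (inj₁ c∈X , _) , _ = ⊥-elim (off-X c∈cs c∈X)
      ... | (inj₂ c∈P , c≢z) , _ = c∈P , c≢z

    v∈X⁺ : XPlus z P v
    v∈X⁺ = inj₁ (inj₁ refl) , λ v≡z → P⊆NotX (walk-last∈ G (proj₁ (proj₁ pendant))) (inj₁ (≡.sym v≡z))

    X⁺-boundary : (∀ {w} → S w → w ∈ P) → NbhdSet G (XPlus z P) w → w ≡ z
    X⁺-boundary {w = w} S⊆P ((u , (u∈X∪P , u≢z) , u~w) , w∉X⁺) with w ≟ z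
    ... | yes w≡z = w≡z
    ... | no w≢z = ⊥-elim (boundary-from u∈X∪P)
      where
      w∉X : NotX w
      w∉X w∈X = w∉X⁺ (inj₁ w∈X , w≢z)
      w∉P : w ∉ P
      w∉P w∈P = w∉X⁺ (inj₂ w∈P , w≢z)
      Ww : W w
      Ww = NotX⇒W w∉X
      boundary-from : X u ⊎ u ∈ P → ⊥
      boundary-from (inj₁ (inj₁ refl)) = w∉X (inj₂ (inj₁ u~w))
      boundary-from (inj₁ (inj₂ (inj₁ v~u))) = w∉X (inj₂ (inj₂ (Ww , λ w-cycle →
        w∉P (S⊆P ((Ww , w-cycle) , proj₁ Ww , proj₂ Ww , u , v~u , u~w)))))
      boundary-from (inj₁ (inj₂ (inj₂ u-tree))) = InTree-¬Adj-NotX u-tree w∉X u~w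
      boundary-from (inj₂ u∈P) = w∉P (pendant-closed G pendant u∈P u≢z u~w w∉X)

    reduced⇒S⊈P : Reduced G → ¬ (∀ {w} → S w → w ∈ P)
    reduced⇒S⊈P reduced S⊆P with reduced (XPlus z P) (v , v∈X⁺) (inj₂ (v , v∈X⁺ , Core-forest))
    ... | f , f-inj , f-Γ =
      case f-inj (≡.trans (X⁺-boundary S⊆P (f-Γ zero)) (≡.sym (X⁺-boundary S⊆P (f-Γ (suc zero)))))
      of λ ()

    H-deg : DegAtLeast G NotX z 3 → DegAtLeast G (HVerts z P) z 2
    H-deg deg3 = DegAtLeast-mono G {A = λ w → NotX w × w ∉ P}
      (λ _ (w∉X , w∉P) → HVerts-intro w∉X (⊥-elim ∘ w∉P)) (pendant-last-deg G pendant deg3)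

lemma38 : ∀ {n : ℕ} (G : Graph n) → Connected G → Reduced G → (v : Fin n) →
    let open StdDecomp G v in
    (x y : Fin n) → x < y → S x → S y → (∀ w → S w → w ≡ x ⊎ w ≡ y) →
    (z : Fin n) → ZSpec y z → (P : List (Fin n)) → Path G NotX y z P →
    ¬ (x ∈ P) × DegAtLeast G (HVerts z P) z 2
lemma38 G _ _ v x y x<y _ _ _ z (inj₁ (deg2 , refl)) P path =
  (λ x∈P → Fin.<-irrefl (on-P x∈P) x<y) ,
  DegAtLeast-mono G {A = NotX} (λ _ w∉X → HVerts-intro G v w∉X on-P) deg2
  where
  open StdDecomp G v
  on-P : ∀ {w} → w ∈ P → w ≡ y
  on-P w∈P = singleton⁻ (subst (_ ∈_) (path-self G path) w∈P)
lemma38 G _ reduced v x y _ _ _ S⊆xy z (inj₂ (deg<2 , _ , deg3 , _ , walk , shortest)) P path =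
  x∉P , H-deg G v pendant deg3
  where
  open StdDecomp G v
  pendant : PendantPath G NotX y z P
  pendant = shortest⇒pendant G deg<2 walk shortest path
  x∉P : x ∉ P
  x∉P x∈P = reduced⇒S⊈P G v pendant reduced λ {w} Sw →
    [ (λ { refl → x∈P }) , (λ { refl → walk-head∈ G (proj₁ path) }) ] (S⊆xy w Sw)
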